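{- Let $3\le k<n$ be integers. Let $V$ be a set of words of length $n$ over the alphabet $\{0,1,*\}$ satisfying the following conditions: (1) for every $v\in V$, exactly $k$ of the letters $v_1,\dots,v_n$ belong to $\{0,1\}$ (equivalently, the box encoded by $v$ has cardinality $2^{n-k}$); (2) if $u,v\in V$ are distinct, then there is exactly one index $i\in\{1,\dots,n\}$ such that $\{v_i,u_i\}=\{0,1\}$; (3) if $u,v\in V$ are distinct, then $\{i: u_i\in\{0,1\}\}\neq\{i: v_i\in\{0,1\}\}$. Then $|V|\le 2^k-2$.
   Context: A word $w=w_1\cdots w_n$ over $\{0,1,*\}$ encodes the box $B_1\times\cdots\times B_n\subseteq\{0,1\}^n$, where $B_i=\{0\}$ if $w_i=0$, $B_i=\{1\}$ if $w_i=1$, and $B_i=\{0,1\}$ if $w_i=*$; $|w|$ denotes the cardinality of this box. -}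

module Defs where

open import Data.Nat using (ℕ; zero; suc; _+_)
open import Data.Bool using (Bool; true; false)
open import Data.Vec using (Vec; []; _∷_; map; zipWith)

data Letter : Set where
  𝟘 𝟙 ⋆ : Letter

Word : ℕ → Set
Word n = Vec Letter n

isFixed : Letter → Bool
isFixed 𝟘 = true
isFixed 𝟙 = true
isFixed ⋆ = false

countTrue : ∀ {n} → Vec Bool n → ℕ
countTrue [] = 0
countTrue (true ∷ bs) = suc (countTrue bs)
countTrue (false ∷ bs) = countTrue bs

fixedCount : ∀ {n} → Word n → ℕ
fixedCount w = countTrue (map isFixed w)

support : ∀ {n} → Word n → Vec Bool n
support w = map isFixed w

conflict : Letter → Letter → Bool
conflict 𝟘 𝟙 = true
conflict 𝟙 𝟘 = true
conflict _ _ = false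

conflictCount : ∀ {n} → Word n → Word n → ℕ
conflictCount u v = countTrue (zipWith conflict u v)

module Submission where

-- Proof by Fourier analysis on the cube {0,1}^n. A word u gives the indicator box_u of
-- its box and the character χ_u(x) = ∏_{i fixed in u} (-1)^(xᵢ + uᵢ); both are product
-- functions, so their sums factor coordinatewise: boxes have 2^(n-k) points, χ_u = 1 on
-- box_u, and a position fixed in u but free in w (which distinct supports provide)
-- makes box_w and χ_w orthogonal to χ_u. Conflicts make the boxes disjoint. With gap
-- the indicator of the uncovered points, gap·(1 + χ_u) ≥ 0 sums to (2^k - |V| - 1)2^(n-k),
-- giving |V| + 1 ≤ 2^k. In the equality case every χ_u is -1 off the boxes, and the second
-- moment of P = ∑_u χ_u forces P = 1 on the boxes; evaluating P next to an uncovered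
-- point shows each position is fixed in 0 or 2^(k-1) words, contradicting the double
-- count |V|k = (2^k - 1)k since 2^(k-1) ∤ k.

open import Defs
open import Data.Bool using (Bool; true; false; not)
open import Data.Fin using (Fin; zero; suc)
open import Data.Vec using (Vec; []; _∷_; lookup; map; zipWith; _[_]%=_)
open import Data.List using (List; []; _∷_; length; _++_)
import Data.List
open import Data.List.Properties using (length-map; length-++)
open import Data.List.Membership.Propositional using (_∈_)
open import Data.List.Membership.Propositional.Properties using (∈-map⁺; ∈-map⁻; ∈-++⁺ˡ; ∈-++⁺ʳ)
open import Data.List.Relation.Unary.Any using (here; there)
import Data.List.Relation.Unary.All as All
open import Data.List.Relation.Unary.Unique.Propositional using (Unique)
open import Data.List.Relation.Unary.AllPairs using (_∷_)
open import Data.Product using (∃; _×_; _,_; proj₁; proj₂)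
open import Data.Sum using (_⊎_; inj₁; inj₂)
open import Data.Empty using (⊥; ⊥-elim)
open import Function using (_∘_)
open import Relation.Nullary using (contradiction; yes; no)
open import Relation.Binary.PropositionalEquality
open import Data.Nat using (ℕ; zero; suc)
import Data.Nat as ℕ
import Data.Nat.Properties as ℕP

module Counting where
  open import Data.Nat using (_+_; _*_; _^_; _≤_; _<_; z≤n; s≤s)
  open import Data.Nat.Properties
  open import Data.Nat.Divisibility using (_∣_; divides; _∣0; ∣-refl; ∣m∣n⇒∣m+n; ∣m+n∣m⇒∣n; ∣⇒≤)
  open import Algebra.Properties.CommutativeMonoid.Sum +-0-commutativeMonoid
    using (sum; ∑-distrib-+; sum-replicate-zero)

  Exceeds : ∀ {n} → Vec Bool n → Vec Bool n → Set
  Exceeds s t = ∃ λ i → lookup s i ≡ true × lookup t i ≡ false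

  exceeds-or-below : ∀ {n} (s t : Vec Bool n) → Exceeds s t ⊎
    (countTrue s ≤ countTrue t × (countTrue s ≡ countTrue t → s ≡ t))
  exceeds-or-below [] [] = inj₂ (z≤n , λ _ → refl)
  exceeds-or-below (a ∷ s) (b ∷ t) with exceeds-or-below s t
  ... | inj₁ (i , p) = inj₁ (suc i , p)
  exceeds-or-below (true ∷ s) (false ∷ t) | inj₂ _ = inj₁ (zero , refl , refl)
  exceeds-or-below (true ∷ s) (true ∷ t) | inj₂ (le , eq) =
    inj₂ (s≤s le , λ e → cong (true ∷_) (eq (suc-injective e)))
  exceeds-or-below (false ∷ s) (false ∷ t) | inj₂ (le , eq) =
    inj₂ (le , λ e → cong (false ∷_) (eq e))
  exceeds-or-below (false ∷ s) (true ∷ t) | inj₂ (le , _) =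
    inj₂ (m≤n⇒m≤1+n le , λ e → contradiction (subst (_≤ countTrue t) e le) 1+n≰n)

  exceeds-of-≢ : ∀ {n} (s t : Vec Bool n) → countTrue s ≡ countTrue t → s ≢ t → Exceeds s t
  exceeds-of-≢ s t e ne with exceeds-or-below s t
  ... | inj₁ w = w
  ... | inj₂ (_ , eq) = contradiction (eq e) ne

  true-position : ∀ {n} (s : Vec Bool n) → countTrue s ≢ 0 → ∃ λ i → lookup s i ≡ true
  true-position [] ne = contradiction refl ne
  true-position (true ∷ s) _ = zero , refl
  true-position (false ∷ s) ne with true-position s ne
  ... | i , p = suc i , p

  bit : Bool → ℕ
  bit true = 1
  bit false = 0

  countTrue-sum : ∀ {n} (s : Vec Bool n) → countTrue s ≡ sum (λ i → bit (lookup s i))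
  countTrue-sum [] = refl
  countTrue-sum (true ∷ s) = cong suc (countTrue-sum s)
  countTrue-sum (false ∷ s) = countTrue-sum s

  columnCount : ∀ {n} → List (Vec Bool n) → Fin n → ℕ
  columnCount [] i = 0
  columnCount (s ∷ S) i = bit (lookup s i) + columnCount S i

  columns-total : ∀ {n k} (S : List (Vec Bool n)) → (∀ s → s ∈ S → countTrue s ≡ k) →
    sum (columnCount S) ≡ length S * k
  columns-total {n} [] _ = sum-replicate-zero n
  columns-total (s ∷ S) rows = begin
    sum (columnCount (s ∷ S))
      ≡⟨ ∑-distrib-+ (λ i → bit (lookup s i)) (columnCount S) ⟩
    sum (λ i → bit (lookup s i)) + sum (columnCount S)
      ≡⟨ cong₂ _+_ (trans (sym (countTrue-sum s)) (rows s (here refl)))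
                   (columns-total S (λ t p → rows t (there p))) ⟩
    _ + length S * _ ∎
    where open ≡-Reasoning

  ∣-sum : ∀ {n} h (d : Fin n → ℕ) → (∀ i → h ∣ d i) → h ∣ sum d
  ∣-sum {zero} h d _ = h ∣0
  ∣-sum {suc n} h d div = ∣m∣n⇒∣m+n (div zero) (∣-sum h (d ∘ suc) (div ∘ suc))

  3+j<2^[2+j] : ∀ j → 3 + j < 2 ^ (2 + j)
  3+j<2^[2+j] zero = s≤s (s≤s (s≤s (s≤s z≤n)))
  3+j<2^[2+j] (suc j) = begin-strict
    4 + j                    ≡⟨⟩
    1 + (3 + j)              <⟨ +-mono-≤-< (m^n>0 2 (2 + j)) (3+j<2^[2+j] j) ⟩
    2 ^ (2 + j) + 2 ^ (2 + j) ≡⟨ cong (2 ^ (2 + j) +_) (sym (+-identityʳ _)) ⟩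
    2 ^ (3 + j)              ∎
    where open ≤-Reasoning

  column-obstruction : ∀ {n k m} → 3 ≤ k → suc m ≡ 2 ^ k → (d : Fin n → ℕ) →
    (∀ i → d i ≡ 0 ⊎ 2 * d i ≡ 2 ^ k) → sum d ≢ m * k
  column-obstruction {k = suc k′} {m} (s≤s (s≤s (s≤s {n = j} _))) tight d values total =
    <⇒≱ (3+j<2^[2+j] j) (∣⇒≤ h∣k)
    where
    h : ℕ
    h = 2 ^ k′
    h∣d : ∀ i → h ∣ d i
    h∣d i with values i
    ... | inj₁ d≡0 = subst (h ∣_) (sym d≡0) (h ∣0)
    ... | inj₂ 2d≡2h = subst (h ∣_) (sym (*-cancelˡ-≡ (d i) h 2 2d≡2h)) ∣-refl
    mk+k≡[2k]h : m * suc k′ + suc k′ ≡ (2 * suc k′) * h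
    mk+k≡[2k]h = begin
      m * suc k′ + suc k′ ≡⟨ +-comm (m * suc k′) (suc k′) ⟩
      suc m * suc k′      ≡⟨ cong (_* suc k′) tight ⟩
      (2 * h) * suc k′    ≡⟨ *-assoc 2 h (suc k′) ⟩
      2 * (h * suc k′)    ≡⟨ cong (2 *_) (*-comm h (suc k′)) ⟩
      2 * (suc k′ * h)    ≡⟨ *-assoc 2 (suc k′) h ⟨
      (2 * suc k′) * h    ∎
      where open ≡-Reasoning
    h∣k : h ∣ suc k′
    h∣k = ∣m+n∣m⇒∣n (divides (2 * suc k′) mk+k≡[2k]h) (subst (h ∣_) total (∣-sum h d h∣d))

module Sums where
  open import Data.Integer using (ℤ; +_; -[1+_]; _+_; _-_; _*_; _≤_; 0ℤ; +≤+)
  open import Data.Integer.Base using (nonNegative)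
  open import Data.Integer.Properties
  open import Data.Integer.Tactic.RingSolver using (solve-∀)

  private variable A B : Set

  ∑ : List A → (A → ℤ) → ℤ
  ∑ [] f = 0ℤ
  ∑ (x ∷ xs) f = f x + ∑ xs f

  ∑-cong : ∀ (xs : List A) {f g : A → ℤ} → (∀ x → x ∈ xs → f x ≡ g x) → ∑ xs f ≡ ∑ xs g
  ∑-cong [] _ = refl
  ∑-cong (x ∷ xs) e = cong₂ _+_ (e x (here refl)) (∑-cong xs (λ y p → e y (there p)))

  ∑-+ : ∀ (xs : List A) (f g : A → ℤ) → ∑ xs (λ x → f x + g x) ≡ ∑ xs f + ∑ xs g
  ∑-+ [] f g = refl
  ∑-+ (x ∷ xs) f g = trans (cong (_+_ (f x + g x)) (∑-+ xs f g)) (swap (f x) (g x) _ _)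
    where
    swap : ∀ a b c d → (a + b) + (c + d) ≡ (a + c) + (b + d)
    swap = solve-∀

  ∑-*ˡ : ∀ (xs : List A) (c : ℤ) (f : A → ℤ) → ∑ xs (λ x → c * f x) ≡ c * ∑ xs f
  ∑-*ˡ [] c f = sym (*-zeroʳ c)
  ∑-*ˡ (x ∷ xs) c f = trans (cong (_+_ (c * f x)) (∑-*ˡ xs c f)) (sym (*-distribˡ-+ c (f x) _))

  ∑-*ʳ : ∀ (xs : List A) (f : A → ℤ) (c : ℤ) → ∑ xs (λ x → f x * c) ≡ ∑ xs f * c
  ∑-*ʳ xs f c = trans (∑-cong xs (λ x _ → *-comm (f x) c))
                      (trans (∑-*ˡ xs c f) (*-comm c (∑ xs f)))

  ∑-- : ∀ (xs : List A) (f g : A → ℤ) → ∑ xs (λ x → f x - g x) ≡ ∑ xs f - ∑ xs g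
  ∑-- [] f g = refl
  ∑-- (x ∷ xs) f g = trans (cong (_+_ (f x - g x)) (∑-- xs f g)) (swap (f x) (g x) _ _)
    where
    swap : ∀ a b c d → (a - b) + (c - d) ≡ (a + c) - (b + d)
    swap = solve-∀

  ∑-const : ∀ (xs : List A) (c : ℤ) → ∑ xs (λ _ → c) ≡ + length xs * c
  ∑-const [] c = sym (*-zeroˡ c)
  ∑-const (x ∷ xs) c = trans (cong (_+_ c) (∑-const xs c))
                             (trans (sym (suc-* (+ length xs) c)) (cong (_* c) (sym (pos-+ 1 (length xs)))))

  ∑-++ : ∀ (xs ys : List A) (f : A → ℤ) → ∑ (xs ++ ys) f ≡ ∑ xs f + ∑ ys f
  ∑-++ [] ys f = sym (+-identityˡ _)
  ∑-++ (x ∷ xs) ys f = trans (cong (_+_ (f x)) (∑-++ xs ys f)) (sym (+-assoc (f x) _ _))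

  ∑-zero : ∀ (xs : List A) (f : A → ℤ) → (∀ x → x ∈ xs → f x ≡ 0ℤ) → ∑ xs f ≡ 0ℤ
  ∑-zero xs f z = trans (∑-cong xs z) (trans (∑-const xs 0ℤ) (*-zeroʳ (+ length xs)))

  ∑-single : ∀ {x : A} (xs : List A) (f : A → ℤ) → Unique xs → x ∈ xs →
    (∀ y → y ∈ xs → y ≢ x → f y ≡ 0ℤ) → ∑ xs f ≡ f x
  ∑-single (y ∷ xs) f (y∉xs ∷ _) (here refl) others =
    trans (cong (_+_ (f y)) (∑-zero xs f (λ z p → others z (there p) (λ { refl → All.lookup y∉xs p refl }))))
          (+-identityʳ (f y))
  ∑-single (y ∷ xs) f (y∉xs ∷ uniq) (there p) others =
    trans (cong₂ _+_ (others y (here refl) (All.lookup y∉xs p))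
                     (∑-single xs f uniq p (λ z q → others z (there q))))
          (+-identityˡ _)

  ∑-swap : ∀ (xs : List A) (ys : List B) (f : A → B → ℤ) →
    ∑ xs (λ x → ∑ ys (f x)) ≡ ∑ ys (λ y → ∑ xs (λ x → f x y))
  ∑-swap [] ys f = sym (∑-zero ys (λ _ → 0ℤ) (λ _ _ → refl))
  ∑-swap (x ∷ xs) ys f = trans (cong (_+_ (∑ ys (f x))) (∑-swap xs ys f))
                               (sym (∑-+ ys (f x) (λ y → ∑ xs (λ x′ → f x′ y))))

  ∑-nonneg : ∀ (xs : List A) (f : A → ℤ) → (∀ x → x ∈ xs → 0ℤ ≤ f x) → 0ℤ ≤ ∑ xs f
  ∑-nonneg [] f _ = ≤-refl
  ∑-nonneg (x ∷ xs) f nn = +-mono-≤ (nn x (here refl)) (∑-nonneg xs f (λ y p → nn y (there p)))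

  term≤∑ : ∀ {x : A} (xs : List A) (f : A → ℤ) → (∀ y → y ∈ xs → 0ℤ ≤ f y) → x ∈ xs →
    f x ≤ ∑ xs f
  term≤∑ (y ∷ xs) f nn (here refl) =
    i≤i+j (f y) (∑ xs f) {{nonNegative (∑-nonneg xs f (λ z p → nn z (there p)))}}
  term≤∑ (y ∷ xs) f nn (there p) =
    ≤-trans (term≤∑ xs f (λ z q → nn z (there q)) p)
            (i≤j+i (∑ xs f) (f y) {{nonNegative (nn y (here refl))}})

  ∑-nonneg-zero : ∀ {x : A} (xs : List A) (f : A → ℤ) → (∀ y → y ∈ xs → 0ℤ ≤ f y) →
    ∑ xs f ≡ 0ℤ → x ∈ xs → f x ≡ 0ℤ
  ∑-nonneg-zero xs f nn total p =
    ≤-antisym (subst (_ ≤_) total (term≤∑ xs f nn p)) (nn _ p)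

  ∑-witness : ∀ (xs : List A) (f : A → ℤ) → ∑ xs f ≢ 0ℤ → ∃ λ x → f x ≢ 0ℤ
  ∑-witness [] f ne = contradiction refl ne
  ∑-witness (x ∷ xs) f ne with f x ≟ 0ℤ
  ... | no fx≢0 = x , fx≢0
  ... | yes fx≡0 = ∑-witness xs f (λ rest≡0 → ne (cong₂ _+_ fx≡0 rest≡0))

  square-nonneg : ∀ z → 0ℤ ≤ z * z
  square-nonneg (+ p) = subst (0ℤ ≤_) (pos-* p p) (+≤+ ℕ.z≤n)
  square-nonneg -[1+ p ] = +≤+ ℕ.z≤n

module Cube where
  open import Data.Integer using (ℤ; +_; _+_; _*_; 0ℤ; 1ℤ)
  open import Data.Integer.Properties using (+-identityʳ; *-distribʳ-+; *-zeroʳ; *-commutativeSemigroup)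
  open import Algebra.Properties.CommutativeSemigroup *-commutativeSemigroup using (interchange)
  open Sums

  Point : ℕ → Set
  Point n = Vec Bool n

  cube : (n : ℕ) → List (Point n)
  cube zero = [] ∷ []
  cube (suc n) = Data.List.map (false ∷_) (cube n) ++ Data.List.map (true ∷_) (cube n)

  ∈-cube : ∀ {n} (x : Point n) → x ∈ cube n
  ∈-cube [] = here refl
  ∈-cube {suc n} (false ∷ x) = ∈-++⁺ˡ (∈-map⁺ (false ∷_) (∈-cube x))
  ∈-cube {suc n} (true ∷ x) = ∈-++⁺ʳ _ (∈-map⁺ (true ∷_) (∈-cube x))

  ∑ᶜ : ∀ {n} → (Point n → ℤ) → ℤ
  ∑ᶜ {n} f = ∑ (cube n) f

  ∑ᶜ-cong : ∀ {n} {f g : Point n → ℤ} → (∀ x → f x ≡ g x) → ∑ᶜ f ≡ ∑ᶜ g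
  ∑ᶜ-cong {n} e = ∑-cong (cube n) (λ x _ → e x)

  ∑ᶜ-split : ∀ {n} (f : Point (suc n) → ℤ) →
    ∑ᶜ f ≡ ∑ᶜ (λ x → f (false ∷ x)) + ∑ᶜ (λ x → f (true ∷ x))
  ∑ᶜ-split {n} f = trans (∑-++ (Data.List.map (false ∷_) (cube n)) _ f)
                         (cong₂ _+_ (∑-map (false ∷_) (cube n)) (∑-map (true ∷_) (cube n)))
    where
    ∑-map : ∀ (g : Point n → Point (suc n)) (xs : List (Point n)) →
      ∑ (Data.List.map g xs) f ≡ ∑ xs (f ∘ g)
    ∑-map g [] = refl
    ∑-map g (x ∷ xs) = cong (_+_ (f (g x))) (∑-map g xs)

  ∑ᶜ-const : ∀ {n} (c : ℤ) → ∑ᶜ {n} (λ _ → c) ≡ + (2 ℕ.^ n) * c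
  ∑ᶜ-const {n} c = trans (∑-const (cube n) c) (cong (λ l → + l * c) (length-cube n))
    where
    length-cube : ∀ n → length (cube n) ≡ 2 ℕ.^ n
    length-cube zero = refl
    length-cube (suc n) = trans (length-++ (Data.List.map (false ∷_) (cube n)))
      (cong₂ ℕ._+_ (trans (length-map _ (cube n)) (length-cube n))
                   (trans (length-map _ (cube n)) (trans (length-cube n) (sym (ℕP.+-identityʳ _)))))

  Factor : Set
  Factor = Bool → ℤ

  mass : Factor → ℤ
  mass α = α false + α true

  _·_ : Factor → Factor → Factor
  (α · β) b = α b * β b

  tensor : ∀ {n} → Vec Factor n → Point n → ℤ
  tensor [] [] = 1ℤ
  tensor (α ∷ αs) (b ∷ x) = α b * tensor αs x

  tensorMass : ∀ {n} → Vec Factor n → ℤ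
  tensorMass [] = 1ℤ
  tensorMass (α ∷ αs) = mass α * tensorMass αs

  ∑ᶜ-tensor : ∀ {n} (αs : Vec Factor n) → ∑ᶜ (tensor αs) ≡ tensorMass αs
  ∑ᶜ-tensor [] = +-identityʳ 1ℤ
  ∑ᶜ-tensor (α ∷ αs) = begin
    ∑ᶜ (tensor (α ∷ αs))
      ≡⟨ ∑ᶜ-split (tensor (α ∷ αs)) ⟩
    ∑ᶜ (λ x → α false * tensor αs x) + ∑ᶜ (λ x → α true * tensor αs x)
      ≡⟨ cong₂ _+_ (∑-*ˡ (cube _) (α false) (tensor αs)) (∑-*ˡ (cube _) (α true) (tensor αs)) ⟩
    α false * ∑ᶜ (tensor αs) + α true * ∑ᶜ (tensor αs)
      ≡⟨ *-distribʳ-+ (∑ᶜ (tensor αs)) (α false) (α true) ⟨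
    mass α * ∑ᶜ (tensor αs)
      ≡⟨ cong (mass α *_) (∑ᶜ-tensor αs) ⟩
    tensorMass (α ∷ αs) ∎
    where open ≡-Reasoning

  tensorMass-zero : ∀ {n} (αs : Vec Factor n) (i : Fin n) →
    mass (lookup αs i) ≡ 0ℤ → tensorMass αs ≡ 0ℤ
  tensorMass-zero (α ∷ αs) zero m≡0 = cong (_* tensorMass αs) m≡0
  tensorMass-zero (α ∷ αs) (suc i) m≡0 =
    trans (cong (mass α *_) (tensorMass-zero αs i m≡0)) (*-zeroʳ (mass α))

  ∑ᶜ-vanishes : ∀ {n} (αs : Vec Factor n) (i : Fin n) →
    mass (lookup αs i) ≡ 0ℤ → ∑ᶜ (tensor αs) ≡ 0ℤ
  ∑ᶜ-vanishes αs i m≡0 = trans (∑ᶜ-tensor αs) (tensorMass-zero αs i m≡0)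

  tensor-* : ∀ {n} (αs βs : Vec Factor n) (x : Point n) →
    tensor αs x * tensor βs x ≡ tensor (zipWith _·_ αs βs) x
  tensor-* [] [] [] = refl
  tensor-* (α ∷ αs) (β ∷ βs) (b ∷ x) =
    trans (interchange (α b) (tensor αs x) (β b) (tensor βs x))
          (cong (_*_ (α b * β b)) (tensor-* αs βs x))

module Boxes where
  open import Data.Integer using (ℤ; +_; _+_; _*_; 0ℤ; 1ℤ; -1ℤ)
  open import Data.Integer.Properties
  open import Data.Integer.Tactic.RingSolver using (solve-∀)
  open import Algebra.Properties.CommutativeSemigroup *-commutativeSemigroup
    using (interchange; x∙yz≈y∙xz)
  open import Data.Vec.Properties using (lookup-map; lookup-zipWith)
  open Counting using (exceeds-of-≢; true-position)
  open Sums
  open Cube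

  ind : Letter → Factor
  ind 𝟘 false = 1ℤ
  ind 𝟘 true = 0ℤ
  ind 𝟙 false = 0ℤ
  ind 𝟙 true = 1ℤ
  ind ⋆ _ = 1ℤ

  sgn : Letter → Factor
  sgn 𝟘 false = 1ℤ
  sgn 𝟘 true = -1ℤ
  sgn 𝟙 false = -1ℤ
  sgn 𝟙 true = 1ℤ
  sgn ⋆ _ = 1ℤ

  box : ∀ {n} → Word n → Point n → ℤ
  box u = tensor (map ind u)

  χ : ∀ {n} → Word n → Point n → ℤ
  χ u = tensor (map sgn u)

  Bit : ℤ → Set
  Bit z = z ≡ 0ℤ ⊎ z ≡ 1ℤ

  Sign : ℤ → Set
  Sign z = z ≡ 1ℤ ⊎ z ≡ -1ℤ

  box-bit : ∀ {n} (u : Word n) x → Bit (box u x)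
  box-bit [] [] = inj₂ refl
  box-bit (a ∷ u) (b ∷ x) = mult (letter a b) (box-bit u x)
    where
    letter : ∀ a b → Bit (ind a b)
    letter 𝟘 false = inj₂ refl
    letter 𝟘 true = inj₁ refl
    letter 𝟙 false = inj₁ refl
    letter 𝟙 true = inj₂ refl
    letter ⋆ _ = inj₂ refl
    mult : ∀ {p q} → Bit p → Bit q → Bit (p * q)
    mult (inj₁ refl) _ = inj₁ refl
    mult (inj₂ refl) q = subst Bit (sym (*-identityˡ _)) q

  χ-sign : ∀ {n} (u : Word n) x → Sign (χ u x)
  χ-sign [] [] = inj₁ refl
  χ-sign (a ∷ u) (b ∷ x) = mult (letter a b) (χ-sign u x)
    where
    letter : ∀ a b → Sign (sgn a b)
    letter 𝟘 false = inj₁ refl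
    letter 𝟘 true = inj₂ refl
    letter 𝟙 false = inj₂ refl
    letter 𝟙 true = inj₁ refl
    letter ⋆ _ = inj₁ refl
    mult : ∀ {p q} → Sign p → Sign q → Sign (p * q)
    mult (inj₁ refl) (inj₁ refl) = inj₁ refl
    mult (inj₁ refl) (inj₂ refl) = inj₂ refl
    mult (inj₂ refl) (inj₁ refl) = inj₂ refl
    mult (inj₂ refl) (inj₂ refl) = inj₁ refl

  sign-square : ∀ {z} → Sign z → z * z ≡ 1ℤ
  sign-square (inj₁ refl) = refl
  sign-square (inj₂ refl) = refl

  box-χ : ∀ {n} (u : Word n) x → box u x * χ u x ≡ box u x
  box-χ [] [] = refl
  box-χ (a ∷ u) (b ∷ x) =
    trans (interchange (ind a b) (box u x) (sgn a b) (χ u x)) (cong₂ _*_ (letter a b) (box-χ u x))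
    where
    letter : ∀ a b → ind a b * sgn a b ≡ ind a b
    letter 𝟘 false = refl
    letter 𝟘 true = refl
    letter 𝟙 false = refl
    letter 𝟙 true = refl
    letter ⋆ _ = refl

  box-volume : ∀ {n} (u : Word n) → + (2 ℕ.^ fixedCount u) * ∑ᶜ (box u) ≡ + (2 ℕ.^ n)
  box-volume u = trans (cong (_*_ (+ (2 ℕ.^ fixedCount u))) (∑ᶜ-tensor (map ind u))) (volume u)
    where
    open ≡-Reasoning
    -- A fixed letter doubles the ambient cube but not the box; a free letter doubles both.
    fixed : ∀ c n t → + (2 ℕ.^ c) * t ≡ + (2 ℕ.^ n) →
      + (2 ℕ.^ suc c) * (1ℤ * t) ≡ + (2 ℕ.^ suc n)
    fixed c n t e = begin
      + (2 ℕ.^ suc c) * (1ℤ * t)   ≡⟨ cong (_* (1ℤ * t)) (pos-* 2 (2 ℕ.^ c)) ⟩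
      (+ 2 * + (2 ℕ.^ c)) * (1ℤ * t) ≡⟨ rearrange (+ (2 ℕ.^ c)) t ⟩
      + 2 * (+ (2 ℕ.^ c) * t)       ≡⟨ cong (_*_ (+ 2)) e ⟩
      + 2 * + (2 ℕ.^ n)             ≡⟨ pos-* 2 (2 ℕ.^ n) ⟨
      + (2 ℕ.^ suc n)               ∎
      where
      rearrange : ∀ p t → (+ 2 * p) * (1ℤ * t) ≡ + 2 * (p * t)
      rearrange = solve-∀
    free : ∀ c n t → + (2 ℕ.^ c) * t ≡ + (2 ℕ.^ n) → + (2 ℕ.^ c) * (+ 2 * t) ≡ + (2 ℕ.^ suc n)
    free c n t e = begin
      + (2 ℕ.^ c) * (+ 2 * t) ≡⟨ rearrange (+ (2 ℕ.^ c)) t ⟩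
      + 2 * (+ (2 ℕ.^ c) * t) ≡⟨ cong (_*_ (+ 2)) e ⟩
      + 2 * + (2 ℕ.^ n)       ≡⟨ pos-* 2 (2 ℕ.^ n) ⟨
      + (2 ℕ.^ suc n)         ∎
      where
      rearrange : ∀ p t → p * (+ 2 * t) ≡ + 2 * (p * t)
      rearrange = solve-∀
    volume : ∀ {n} (u : Word n) → + (2 ℕ.^ fixedCount u) * tensorMass (map ind u) ≡ + (2 ℕ.^ n)
    volume [] = refl
    volume {suc n} (𝟘 ∷ u) = fixed (fixedCount u) n _ (volume u)
    volume {suc n} (𝟙 ∷ u) = fixed (fixedCount u) n _ (volume u)
    volume {suc n} (⋆ ∷ u) = free (fixedCount u) n _ (volume u)

  -- Position i is fixed in u but free in w; this makes the box of w and the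
  -- character of u (and the characters of u and w) orthogonal.
  FixedWhereFree : ∀ {n} → Word n → Word n → Fin n → Set
  FixedWhereFree u w i = isFixed (lookup u i) ≡ true × lookup w i ≡ ⋆

  lookup-product : ∀ {n} (f g : Letter → Factor) (u w : Word n) (i : Fin n) →
    lookup (zipWith _·_ (map f u) (map g w)) i ≡ f (lookup u i) · g (lookup w i)
  lookup-product f g u w i =
    trans (lookup-zipWith _·_ i (map f u) (map g w)) (cong₂ _·_ (lookup-map i f u) (lookup-map i g w))

  χ-balanced : ∀ {n} (u : Word n) (i : Fin n) → isFixed (lookup u i) ≡ true → ∑ᶜ (χ u) ≡ 0ℤ
  χ-balanced u i fixed =
    ∑ᶜ-vanishes (map sgn u) i (trans (cong mass (lookup-map i sgn u)) (balanced (lookup u i) fixed))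
    where
    balanced : ∀ a → isFixed a ≡ true → mass (sgn a) ≡ 0ℤ
    balanced 𝟘 _ = refl
    balanced 𝟙 _ = refl

  letterwise-orthogonal : ∀ {n} (f g : Letter → Factor) (u w : Word n) (i : Fin n) →
    mass (f (lookup u i) · g (lookup w i)) ≡ 0ℤ → ∑ᶜ (λ x → tensor (map f u) x * tensor (map g w) x) ≡ 0ℤ
  letterwise-orthogonal f g u w i massless =
    trans (∑ᶜ-cong (tensor-* (map f u) (map g w)))
          (∑ᶜ-vanishes (zipWith _·_ (map f u) (map g w)) i
                       (trans (cong mass (lookup-product f g u w i)) massless))

  box-χ-orthogonal : ∀ {n} (u w : Word n) (i : Fin n) → FixedWhereFree u w i →
    ∑ᶜ (λ x → box w x * χ u x) ≡ 0ℤ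
  box-χ-orthogonal u w i (fixed , free) =
    letterwise-orthogonal ind sgn w u i (balanced (lookup u i) (lookup w i) fixed free)
    where
    balanced : ∀ a c → isFixed a ≡ true → c ≡ ⋆ → mass (ind c · sgn a) ≡ 0ℤ
    balanced 𝟘 ⋆ _ _ = refl
    balanced 𝟙 ⋆ _ _ = refl

  χ-orthogonal : ∀ {n} (u w : Word n) (i : Fin n) → FixedWhereFree u w i →
    ∑ᶜ (λ x → χ u x * χ w x) ≡ 0ℤ
  χ-orthogonal u w i (fixed , free) =
    letterwise-orthogonal sgn sgn u w i (balanced (lookup u i) (lookup w i) fixed free)
    where
    balanced : ∀ a c → isFixed a ≡ true → c ≡ ⋆ → mass (sgn a · sgn c) ≡ 0ℤ
    balanced 𝟘 ⋆ _ _ = refl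
    balanced 𝟙 ⋆ _ _ = refl

  boxes-disjoint : ∀ {n} (u v : Word n) x → conflictCount u v ≢ 0 → box u x * box v x ≡ 0ℤ
  boxes-disjoint [] [] [] ne = contradiction refl ne
  boxes-disjoint (a ∷ u) (c ∷ v) (b ∷ x) ne with conflict a c in clash
  ... | true = trans (interchange (ind a b) (box u x) (ind c b) (box v x))
                     (trans (cong (_* (box u x * box v x)) (excluded a c b clash))
                            (*-zeroˡ (box u x * box v x)))
    where
    excluded : ∀ a c b → conflict a c ≡ true → ind a b * ind c b ≡ 0ℤ
    excluded 𝟘 𝟙 false _ = refl
    excluded 𝟘 𝟙 true _ = refl
    excluded 𝟙 𝟘 false _ = refl
    excluded 𝟙 𝟘 true _ = refl
  ... | false = trans (interchange (ind a b) (box u x) (ind c b) (box v x))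
                      (trans (cong (_*_ (ind a b * ind c b)) (boxes-disjoint u v x ne))
                             (*-zeroʳ (ind a b * ind c b)))

  flipSign : Letter → ℤ
  flipSign 𝟘 = -1ℤ
  flipSign 𝟙 = -1ℤ
  flipSign ⋆ = 1ℤ

  χ-flip : ∀ {n} (u : Word n) (i : Fin n) x → χ u (x [ i ]%= not) ≡ flipSign (lookup u i) * χ u x
  χ-flip (a ∷ u) zero (b ∷ x) =
    trans (cong (_* χ u x) (letter a b)) (*-assoc (flipSign a) (sgn a b) (χ u x))
    where
    letter : ∀ a b → sgn a (not b) ≡ flipSign a * sgn a b
    letter 𝟘 false = refl
    letter 𝟘 true = refl
    letter 𝟙 false = refl
    letter 𝟙 true = refl
    letter ⋆ _ = refl
  χ-flip (a ∷ u) (suc i) (b ∷ x) =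
    trans (cong (_*_ (sgn a b)) (χ-flip u i x)) (x∙yz≈y∙xz (sgn a b) (flipSign (lookup u i)) (χ u x))

  separating-position : ∀ {n} (u w : Word n) → fixedCount u ≡ fixedCount w → support u ≢ support w →
    ∃ (FixedWhereFree u w)
  separating-position u w same ne with exceeds-of-≢ (support u) (support w) same ne
  ... | i , u-fixed , w-free =
    i , trans (sym (lookup-map i isFixed u)) u-fixed ,
    free (lookup w i) (trans (sym (lookup-map i isFixed w)) w-free)
    where
    free : ∀ c → isFixed c ≡ false → c ≡ ⋆
    free ⋆ _ = refl

  fixed-position : ∀ {n} (u : Word n) → fixedCount u ≢ 0 → ∃ λ i → isFixed (lookup u i) ≡ true
  fixed-position u ne with true-position (support u) ne
  ... | i , p = i , trans (sym (lookup-map i isFixed u)) p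

  cover-at-most-once : ∀ {n} (W : List (Word n)) → Unique W →
    (∀ u v → u ∈ W → v ∈ W → u ≢ v → conflictCount u v ≢ 0) →
    ∀ x → Bit (∑ W (λ u → box u x))
  cover-at-most-once [] _ _ x = inj₁ refl
  cover-at-most-once (u ∷ W) (u∉W ∷ uniq) clash x with box-bit u x
  ... | inj₁ outside = subst Bit (sym (trans (cong (_+ ∑ W (λ v → box v x)) outside) (+-identityˡ _)))
                             (cover-at-most-once W uniq (λ v w p q → clash v w (there p) (there q)) x)
  ... | inj₂ inside = inj₂ (cong₂ _+_ inside (∑-zero W (λ v → box v x) elsewhere))
    where
    elsewhere : ∀ v → v ∈ W → box v x ≡ 0ℤ
    elsewhere v p = begin
      box v x               ≡⟨ *-identityˡ (box v x) ⟨
      1ℤ * box v x          ≡⟨ cong (_* box v x) inside ⟨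
      box u x * box v x     ≡⟨ boxes-disjoint u v x (clash u v (here refl) (there p) u≢v) ⟩
      0ℤ                    ∎
      where
      open ≡-Reasoning
      u≢v : u ≢ v
      u≢v refl = All.lookup u∉W p refl

member-or-empty : ∀ {A : Set} (W : List A) → (∃ λ u → u ∈ W) ⊎ length W ≡ 0
member-or-empty [] = inj₂ refl
member-or-empty (u ∷ _) = inj₁ (u , here refl)

module Packing {k n : ℕ} (3≤k : 3 ℕ.≤ k) (k≤n : k ℕ.≤ n)
  (V : List (Word n)) (uniq : Unique V)
  (fixed : ∀ v → v ∈ V → fixedCount v ≡ k)
  (conflicting : ∀ u v → u ∈ V → v ∈ V → u ≢ v → conflictCount u v ≡ 1)
  (distinct : ∀ u v → u ∈ V → v ∈ V → u ≢ v → support u ≢ support v) where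

  open import Data.Integer using (ℤ; +_; -_; _+_; _-_; _*_; _≤_; _<_; 0ℤ; 1ℤ; -1ℤ; +≤+; +<+)
  open import Data.Integer.Base using (positive)
  open import Data.Integer.Properties
  open import Data.Integer.Tactic.RingSolver using (solve-∀)
  open import Data.Vec.Properties using (lookup-map)
  open Counting using (bit; columnCount; columns-total; column-obstruction)
  open Sums
  open Cube
  open Boxes

  m : ℕ
  m = length V

  M K B N : ℤ
  M = + m
  K = + (2 ℕ.^ k)
  B = + (2 ℕ.^ (n ℕ.∸ k))
  N = + (2 ℕ.^ n)

  K*B≡N : K * B ≡ N
  K*B≡N = trans (sym (pos-* (2 ℕ.^ k) _))
    (cong +_ (trans (sym (ℕP.^-distribˡ-+-* 2 k (n ℕ.∸ k))) (cong (2 ℕ.^_) (ℕP.m+[n∸m]≡n k≤n))))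

  box-size : ∀ u → u ∈ V → ∑ᶜ (box u) ≡ B
  box-size u p = *-cancelˡ-≡ K (∑ᶜ (box u)) B {{ℕP.m^n≢0 2 k}}
    (trans (subst (λ c → + (2 ℕ.^ c) * ∑ᶜ (box u) ≡ N) (fixed u p) (box-volume u)) (sym K*B≡N))

  χ-sum : ∀ u → u ∈ V → ∑ᶜ (χ u) ≡ 0ℤ
  χ-sum u p with fixed-position u (λ u-free → ℕP.m<n⇒n≢0 3≤k (trans (sym (fixed u p)) u-free))
  ... | i , i-fixed = χ-balanced u i i-fixed

  separated : ∀ u w → u ∈ V → w ∈ V → w ≢ u → ∃ (FixedWhereFree u w)
  separated u w p q w≢u =
    separating-position u w (trans (fixed u p) (sym (fixed w q))) (distinct u w p q (λ u≡w → w≢u (sym u≡w)))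

  cover gap : Point n → ℤ
  cover x = ∑ V (λ u → box u x)
  gap x = 1ℤ - cover x

  -- Condition (2) makes the boxes of V disjoint.
  cover-bit : ∀ x → Bit (cover x)
  cover-bit = cover-at-most-once V uniq
    (λ u v p q u≢v c≡0 → ℕP.0≢1+n (trans (sym c≡0) (conflicting u v p q u≢v)))

  ∑-cover : ∑ᶜ cover ≡ M * B
  ∑-cover = trans (∑-swap (cube n) V (λ x u → box u x)) (trans (∑-cong V box-size) (∑-const V B))

  -- Only the box of u itself correlates with χ_u.
  ∑-cover-χ : ∀ u → u ∈ V → ∑ᶜ (λ x → cover x * χ u x) ≡ B
  ∑-cover-χ u p = begin
    ∑ᶜ (λ x → cover x * χ u x)                  ≡⟨ ∑ᶜ-cong (λ x → sym (∑-*ʳ V (λ w → box w x) (χ u x))) ⟩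
    ∑ᶜ (λ x → ∑ V (λ w → box w x * χ u x))      ≡⟨ ∑-swap (cube n) V (λ x w → box w x * χ u x) ⟩
    ∑ V (λ w → ∑ᶜ (λ x → box w x * χ u x))      ≡⟨ ∑-single V _ uniq p others ⟩
    ∑ᶜ (λ x → box u x * χ u x)                  ≡⟨ ∑ᶜ-cong (box-χ u) ⟩
    ∑ᶜ (box u)                                  ≡⟨ box-size u p ⟩
    B                                           ∎
    where
    open ≡-Reasoning
    others : ∀ w → w ∈ V → w ≢ u → ∑ᶜ (λ x → box w x * χ u x) ≡ 0ℤ
    others w q w≢u with separated u w p q w≢u
    ... | i , sep = box-χ-orthogonal u w i sep

  ∑-gap : ∑ᶜ gap ≡ N - M * B
  ∑-gap = trans (∑-- (cube n) (λ _ → 1ℤ) cover)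
                (cong₂ _-_ (trans (∑ᶜ-const {n} 1ℤ) (*-identityʳ N)) ∑-cover)

  ∑-gap-χ : ∀ u → u ∈ V → ∑ᶜ (λ x → gap x * χ u x) ≡ - B
  ∑-gap-χ u p = begin
    ∑ᶜ (λ x → gap x * χ u x)                 ≡⟨ ∑ᶜ-cong (λ x → expand (cover x) (χ u x)) ⟩
    ∑ᶜ (λ x → χ u x - cover x * χ u x)       ≡⟨ ∑-- (cube n) (χ u) (λ x → cover x * χ u x) ⟩
    ∑ᶜ (χ u) - ∑ᶜ (λ x → cover x * χ u x)    ≡⟨ cong₂ _-_ (χ-sum u p) (∑-cover-χ u p) ⟩
    0ℤ - B                                   ≡⟨ +-identityˡ (- B) ⟩
    - B                                      ∎
    where
    open ≡-Reasoning
    expand : ∀ c s → (1ℤ - c) * s ≡ s - c * s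
    expand = solve-∀

  test : Word n → Point n → ℤ
  test u x = gap x * (1ℤ + χ u x)

  test-nonneg : ∀ u x → 0ℤ ≤ test u x
  test-nonneg u x = nonneg (cover-bit x) (χ-sign u x)
    where
    nonneg : ∀ {c s} → Bit c → Sign s → 0ℤ ≤ (1ℤ - c) * (1ℤ + s)
    nonneg (inj₁ refl) (inj₁ refl) = +≤+ ℕ.z≤n
    nonneg (inj₁ refl) (inj₂ refl) = +≤+ ℕ.z≤n
    nonneg (inj₂ refl) (inj₁ refl) = +≤+ ℕ.z≤n
    nonneg (inj₂ refl) (inj₂ refl) = +≤+ ℕ.z≤n

  ∑-test : ∀ u → u ∈ V → ∑ᶜ (test u) ≡ (K - (1ℤ + M)) * B
  ∑-test u p = begin
    ∑ᶜ (test u)                                         ≡⟨ ∑ᶜ-cong (λ x → *-distribˡ-+ (gap x) 1ℤ (χ u x)) ⟩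
    ∑ᶜ (λ x → gap x * 1ℤ + gap x * χ u x)               ≡⟨ ∑-+ (cube n) _ _ ⟩
    ∑ᶜ (λ x → gap x * 1ℤ) + ∑ᶜ (λ x → gap x * χ u x)
      ≡⟨ cong₂ _+_ (trans (∑ᶜ-cong (λ x → *-identityʳ (gap x))) ∑-gap) (∑-gap-χ u p) ⟩
    N - M * B + - B                                     ≡⟨ cong (λ t → t - M * B + - B) K*B≡N ⟨
    K * B - M * B + - B                                 ≡⟨ collect K M B ⟩
    (K - (1ℤ + M)) * B                                  ∎
    where
    open ≡-Reasoning
    collect : ∀ k m b → k * b - m * b + - b ≡ (k - (1ℤ + m)) * b
    collect = solve-∀

  B-positive : 0ℤ < B
  B-positive = +<+ (ℕP.m^n>0 2 (n ℕ.∸ k))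

  size-bound : ∀ u → u ∈ V → suc m ℕ.≤ 2 ℕ.^ k
  size-bound u p = drop‿+≤+ (subst (_≤ K) (sym (pos-+ 1 m)) (0≤i-j⇒j≤i 0≤K-[1+M]))
    where
    0≤[K-[1+M]]B : 0ℤ * B ≤ (K - (1ℤ + M)) * B
    0≤[K-[1+M]]B =
      subst₂ _≤_ (sym (*-zeroˡ B)) (∑-test u p) (∑-nonneg (cube n) (test u) (λ x _ → test-nonneg u x))
    0≤K-[1+M] : 0ℤ ≤ K - (1ℤ + M)
    0≤K-[1+M] = *-cancelʳ-≤-pos 0ℤ (K - (1ℤ + M)) B {{positive B-positive}} 0≤[K-[1+M]]B

  module Tight (tight : suc m ≡ 2 ℕ.^ k) where

    1+M≡K : 1ℤ + M ≡ K
    1+M≡K = trans (sym (pos-+ 1 m)) (cong +_ tight)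

    -- Each test function vanishes identically, so every χ_u is -1 off the union of the boxes.
    χ-uncovered : ∀ u → u ∈ V → ∀ x → cover x ≡ 0ℤ → χ u x ≡ -1ℤ
    χ-uncovered u p x uncovered =
      forced (χ-sign u x) (subst (λ c → (1ℤ - c) * (1ℤ + χ u x) ≡ 0ℤ) uncovered test≡0)
      where
      ∑-test≡0 : ∑ᶜ (test u) ≡ 0ℤ
      ∑-test≡0 = trans (∑-test u p) (trans (cong (λ t → (K - t) * B) 1+M≡K) (cong (_* B) (+-inverseʳ K)))
      test≡0 : test u x ≡ 0ℤ
      test≡0 = ∑-nonneg-zero (cube n) (test u) (λ y _ → test-nonneg u y) ∑-test≡0 (∈-cube x)
      forced : ∀ {s} → Sign s → (1ℤ - 0ℤ) * (1ℤ + s) ≡ 0ℤ → s ≡ -1ℤ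
      forced (inj₁ refl) ()
      forced (inj₂ refl) _ = refl

    N≡[1+M]B : N ≡ (1ℤ + M) * B
    N≡[1+M]B = trans (sym K*B≡N) (cong (_* B) (sym 1+M≡K))

    ∑-gap≡B : ∑ᶜ gap ≡ B
    ∑-gap≡B = trans ∑-gap (trans (cong (_- M * B) N≡[1+M]B) (cancel M B))
      where
      cancel : ∀ m b → (1ℤ + m) * b - m * b ≡ b
      cancel = solve-∀

    uncovered-point : ∃ λ x → cover x ≡ 0ℤ
    uncovered-point with ∑-witness (cube n) gap (λ ∑≡0 → <⇒≢ B-positive (trans (sym ∑≡0) ∑-gap≡B))
    ... | x , gap≢0 with cover-bit x
    ...   | inj₁ uncovered = x , uncovered
    ...   | inj₂ covered = contradiction (cong (_-_ 1ℤ) covered) gap≢0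

    P : Point n → ℤ
    P x = ∑ V (λ u → χ u x)

    P-uncovered : ∀ x → cover x ≡ 0ℤ → P x ≡ - M
    P-uncovered x uncovered =
      trans (∑-cong V (λ u p → χ-uncovered u p x uncovered))
            (trans (∑-const V -1ℤ) (trans (*-comm M -1ℤ) (-1*i≡-i M)))

    ∑-P : ∑ᶜ P ≡ 0ℤ
    ∑-P = trans (∑-swap (cube n) V (λ x u → χ u x)) (∑-zero V (λ u → ∑ᶜ (χ u)) χ-sum)

    ∑-χ-P : ∀ u → u ∈ V → ∑ᶜ (λ x → χ u x * P x) ≡ N
    ∑-χ-P u p = begin
      ∑ᶜ (λ x → χ u x * P x)                  ≡⟨ ∑ᶜ-cong (λ x → sym (∑-*ˡ V (χ u x) (λ w → χ w x))) ⟩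
      ∑ᶜ (λ x → ∑ V (λ w → χ u x * χ w x))    ≡⟨ ∑-swap (cube n) V (λ x w → χ u x * χ w x) ⟩
      ∑ V (λ w → ∑ᶜ (λ x → χ u x * χ w x))    ≡⟨ ∑-single V _ uniq p others ⟩
      ∑ᶜ (λ x → χ u x * χ u x)                ≡⟨ ∑ᶜ-cong (λ x → sign-square (χ-sign u x)) ⟩
      ∑ᶜ {n} (λ _ → 1ℤ)                       ≡⟨ trans (∑ᶜ-const {n} 1ℤ) (*-identityʳ N) ⟩
      N                                       ∎
      where
      open ≡-Reasoning
      others : ∀ w → w ∈ V → w ≢ u → ∑ᶜ (λ x → χ u x * χ w x) ≡ 0ℤ
      others w q w≢u with separated u w p q w≢u
      ... | i , sep = χ-orthogonal u w i sep

    ∑-P² : ∑ᶜ (λ x → P x * P x) ≡ M * N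
    ∑-P² = begin
      ∑ᶜ (λ x → P x * P x)                    ≡⟨ ∑ᶜ-cong (λ x → sym (∑-*ʳ V (λ u → χ u x) (P x))) ⟩
      ∑ᶜ (λ x → ∑ V (λ u → χ u x * P x))      ≡⟨ ∑-swap (cube n) V (λ x u → χ u x * P x) ⟩
      ∑ V (λ u → ∑ᶜ (λ x → χ u x * P x))      ≡⟨ trans (∑-cong V ∑-χ-P) (∑-const V N) ⟩
      M * N                                   ∎
      where open ≡-Reasoning

    defect : Point n → ℤ
    defect x = (P x - 1ℤ) * (P x - 1ℤ)

    -- The total defect equals the defect carried by the uncovered points alone.
    ∑-defect : ∑ᶜ defect ≡ (1ℤ + M) * N
    ∑-defect = begin
      ∑ᶜ defect                                            ≡⟨ ∑ᶜ-cong (λ x → expand (P x)) ⟩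
      ∑ᶜ (λ x → P x * P x - (+ 2 * P x - 1ℤ))             ≡⟨ ∑-- (cube n) _ _ ⟩
      ∑ᶜ (λ x → P x * P x) - ∑ᶜ (λ x → + 2 * P x - 1ℤ)
        ≡⟨ cong (_-_ (∑ᶜ (λ x → P x * P x))) ∑-linear ⟩
      ∑ᶜ (λ x → P x * P x) - (+ 2 * 0ℤ - N * 1ℤ)          ≡⟨ cong (_- (+ 2 * 0ℤ - N * 1ℤ)) ∑-P² ⟩
      M * N - (+ 2 * 0ℤ - N * 1ℤ)                         ≡⟨ collect M N ⟩
      (1ℤ + M) * N                                        ∎
      where
      open ≡-Reasoning
      expand : ∀ p → (p - 1ℤ) * (p - 1ℤ) ≡ p * p - (+ 2 * p - 1ℤ)
      expand = solve-∀
      collect : ∀ m N → m * N - (+ 2 * 0ℤ - N * 1ℤ) ≡ (1ℤ + m) * N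
      collect = solve-∀
      ∑-linear : ∑ᶜ (λ x → + 2 * P x - 1ℤ) ≡ + 2 * 0ℤ - N * 1ℤ
      ∑-linear = trans (∑-- (cube n) (λ x → + 2 * P x) (λ _ → 1ℤ))
        (cong₂ _-_ (trans (∑-*ˡ (cube n) (+ 2) P) (cong (_*_ (+ 2)) ∑-P)) (∑ᶜ-const {n} 1ℤ))

    ∑-gap-defect : ∑ᶜ (λ x → gap x * defect x) ≡ (1ℤ + M) * N
    ∑-gap-defect = begin
      ∑ᶜ (λ x → gap x * defect x)                ≡⟨ ∑ᶜ-cong pointwise ⟩
      ∑ᶜ (λ x → ((1ℤ + M) * (1ℤ + M)) * gap x)   ≡⟨ ∑-*ˡ (cube n) ((1ℤ + M) * (1ℤ + M)) gap ⟩
      ((1ℤ + M) * (1ℤ + M)) * ∑ᶜ gap             ≡⟨ cong (_*_ ((1ℤ + M) * (1ℤ + M))) ∑-gap≡B ⟩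
      ((1ℤ + M) * (1ℤ + M)) * B                  ≡⟨ *-assoc (1ℤ + M) (1ℤ + M) B ⟩
      (1ℤ + M) * ((1ℤ + M) * B)                  ≡⟨ cong (_*_ (1ℤ + M)) N≡[1+M]B ⟨
      (1ℤ + M) * N                               ∎
      where
      open ≡-Reasoning
      off-boxes : ∀ m → (1ℤ - 0ℤ) * ((- m - 1ℤ) * (- m - 1ℤ)) ≡
                        ((1ℤ + m) * (1ℤ + m)) * (1ℤ - 0ℤ)
      off-boxes = solve-∀
      pointwise : ∀ x → gap x * defect x ≡ ((1ℤ + M) * (1ℤ + M)) * gap x
      pointwise x with cover-bit x
      ... | inj₁ uncovered rewrite uncovered | P-uncovered x uncovered = off-boxes M
      ... | inj₂ covered rewrite covered =
        trans (*-zeroˡ (defect x)) (sym (*-zeroʳ ((1ℤ + M) * (1ℤ + M))))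

    ∑-cover-defect : ∑ᶜ (λ x → cover x * defect x) ≡ 0ℤ
    ∑-cover-defect = begin
      ∑ᶜ (λ x → cover x * defect x)              ≡⟨ ∑ᶜ-cong (λ x → complement (cover x) (defect x)) ⟩
      ∑ᶜ (λ x → defect x - gap x * defect x)     ≡⟨ ∑-- (cube n) defect (λ x → gap x * defect x) ⟩
      ∑ᶜ defect - ∑ᶜ (λ x → gap x * defect x)    ≡⟨ cong₂ _-_ ∑-defect ∑-gap-defect ⟩
      (1ℤ + M) * N - (1ℤ + M) * N                ≡⟨ +-inverseʳ ((1ℤ + M) * N) ⟩
      0ℤ                                         ∎
      where
      open ≡-Reasoning
      complement : ∀ c d → c * d ≡ d - (1ℤ - c) * d
      complement = solve-∀

    cover-defect-nonneg : ∀ x → 0ℤ ≤ cover x * defect x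
    cover-defect-nonneg x with cover-bit x
    ... | inj₁ uncovered rewrite uncovered = +≤+ ℕ.z≤n
    ... | inj₂ covered rewrite covered =
      subst (0ℤ ≤_) (sym (*-identityˡ (defect x))) (square-nonneg (P x - 1ℤ))

    P-covered : ∀ x → cover x ≡ 1ℤ → P x ≡ 1ℤ
    P-covered x covered with i*j≡0⇒i≡0∨j≡0 (P x - 1ℤ) defect≡0
      where
      defect≡0 : defect x ≡ 0ℤ
      defect≡0 = trans (sym (*-identityˡ (defect x))) (trans (cong (_* defect x) (sym covered))
        (∑-nonneg-zero (cube n) (λ y → cover y * defect y) (λ y _ → cover-defect-nonneg y)
                       ∑-cover-defect (∈-cube x)))
    ... | inj₁ P-1≡0 = i-j≡0⇒i≡j (P x) 1ℤ P-1≡0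
    ... | inj₂ P-1≡0 = i-j≡0⇒i≡j (P x) 1ℤ P-1≡0

    -- Flip each coordinate of an uncovered point x₀: P there equals 2 dᵢ - |V|, where dᵢ is
    -- the number of words fixed at i, and it must be -|V| or 1.
    x₀ : Point n
    x₀ = proj₁ uncovered-point

    d : Fin n → ℕ
    d = columnCount (Data.List.map support V)

    ∑-column : ∀ (W : List (Word n)) i →
      ∑ W (λ u → + bit (isFixed (lookup u i))) ≡ + columnCount (Data.List.map support W) i
    ∑-column [] i = refl
    ∑-column (u ∷ W) i =
      trans (cong₂ _+_ (cong (+_ ∘ bit) (sym (lookup-map i isFixed u))) (∑-column W i))
            (sym (pos-+ (bit (lookup (support u) i)) _))

    P-flip : ∀ i → P (x₀ [ i ]%= not) ≡ + 2 * + d i - M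
    P-flip i = begin
      P (x₀ [ i ]%= not)                                        ≡⟨ ∑-cong V (λ u p → flipped u p) ⟩
      ∑ V (λ u → + 2 * + bit (isFixed (lookup u i)) - 1ℤ)       ≡⟨ ∑-- V _ (λ _ → 1ℤ) ⟩
      ∑ V (λ u → + 2 * + bit (isFixed (lookup u i))) - ∑ V (λ _ → 1ℤ)
        ≡⟨ cong₂ _-_ (trans (∑-*ˡ V (+ 2) _) (cong (_*_ (+ 2)) (∑-column V i)))
                     (trans (∑-const V 1ℤ) (*-identityʳ M)) ⟩
      + 2 * + d i - M                                           ∎
      where
      open ≡-Reasoning
      letter : ∀ a → flipSign a * -1ℤ ≡ + 2 * + bit (isFixed a) - 1ℤ
      letter 𝟘 = refl
      letter 𝟙 = refl
      letter ⋆ = refl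
      flipped : ∀ u → u ∈ V → χ u (x₀ [ i ]%= not) ≡ + 2 * + bit (isFixed (lookup u i)) - 1ℤ
      flipped u p = trans (χ-flip u i x₀)
        (trans (cong (_*_ (flipSign (lookup u i))) (χ-uncovered u p x₀ (proj₂ uncovered-point)))
               (letter (lookup u i)))

    doubled-column : ∀ i t → P (x₀ [ i ]%= not) ≡ t → + (2 ℕ.* d i) ≡ t + M
    doubled-column i t e =
      trans (pos-* 2 (d i)) (trans (isolate (+ 2 * + d i) M) (cong (_+ M) (trans (sym (P-flip i)) e)))
      where
      isolate : ∀ a m → a ≡ (a - m) + m
      isolate = solve-∀

    column-values : ∀ i → d i ≡ 0 ⊎ 2 ℕ.* d i ≡ 2 ℕ.^ k
    column-values i with cover-bit (x₀ [ i ]%= not)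
    ... | inj₁ uncovered = inj₁ (ℕP.*-cancelˡ-≡ (d i) 0 2
            (+-injective (trans (doubled-column i (- M) (P-uncovered _ uncovered)) (+-inverseˡ M))))
    ... | inj₂ covered = inj₂
            (+-injective (trans (doubled-column i 1ℤ (P-covered _ covered)) 1+M≡K))

    impossible : ⊥
    impossible = column-obstruction 3≤k tight d column-values
      (trans (columns-total (Data.List.map support V) rows) (cong (ℕ._* k) (length-map support V)))
      where
      rows : ∀ s → s ∈ Data.List.map support V → countTrue s ≡ k
      rows s p with ∈-map⁻ support p
      ... | u , q , refl = fixed u q

  packing-bound : m ℕ.+ 2 ℕ.≤ 2 ℕ.^ k
  packing-bound with member-or-empty V
  ... | inj₂ empty rewrite empty = ℕP.^-monoʳ-≤ 2 (ℕP.≤-trans (ℕ.s≤s ℕ.z≤n) 3≤k)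
  ... | inj₁ (u , p) with ℕP.m≤n⇒m<n∨m≡n (size-bound u p)
  ...   | inj₁ strict = subst (ℕ._≤ 2 ℕ.^ k) (ℕP.+-comm 2 m) strict
  ...   | inj₂ equal = ⊥-elim (Tight.impossible equal)

-- The natural-number operators of the statement are opened only now: the modules above
-- use the integer ones under the same names.
open import Data.Nat using (_+_; _≤_; _<_; _^_)

theorem1 : (k n : ℕ) → 3 ≤ k → k < n →
    (V : List (Word n)) → Unique V →
    (∀ v → v ∈ V → fixedCount v ≡ k) →
    (∀ u v → u ∈ V → v ∈ V → u ≢ v → conflictCount u v ≡ 1) →
    (∀ u v → u ∈ V → v ∈ V → u ≢ v → support u ≢ support v) →
    length V + 2 ≤ 2 ^ k
theorem1 k n 3≤k k<n V uniq fixed conflicting distinct =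
  Packing.packing-bound 3≤k (ℕP.<⇒≤ k<n) V uniq fixed conflicting distinct
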